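{- For each $\nu\in\{1,2\}$, the sets $\mathscr{U}_x^\nu$ and $\mathscr{T}_x^\nu$ both form commutative semirings under the operations of addition and multiplication of Laurent polynomials.
   Context: For $\nu\in\{1,2\}$, $\mathscr{U}_x^\nu$ denotes the set of Laurent polynomials $f(x)=\sum_{i\in\mathbb{Z}}c_ix^i$ with real coefficients $c_i\ge 0$ such that $c_{ -i}=c_i$ for all integers $i$, and for every integer $r$ with $0\le r<\nu$ and every integer $\ell\ge 0$ one has $c_{r+\ell\nu}\ge c_{r+(\ell+1)\nu}$. $\mathscr{T}_x^\nu$ denotes the set of $f\in\mathscr{U}_x^\nu$ which moreover satisfy $c_{r+\ell\nu}>c_{r+(\ell+1)\nu}$ whenever $c_{r+\ell\nu}>0$ (for $0\le r<\nu$, $\ell\ge 0$). -}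

module Defs where

open import Level using (Level; _⊔_) renaming (suc to lsuc)
open import Algebra.Bundles using (CommutativeRing)
open import Relation.Binary.Core using (Rel)
open import Relation.Binary.Structures using (IsTotalOrder)
open import Data.Integer as ℤ using (ℤ; +_; ∣_∣)
open import Data.Nat as ℕ using (ℕ)
open import Data.List using (List; map; foldr; upTo)
open import Data.Product using (_×_; ∃)
open import Data.Sum using (_⊎_)
open import Relation.Nullary using (¬_; yes; no)
open import Relation.Binary.PropositionalEquality using (_≡_)

record RealNumbers (c ℓ₁ ℓ₂ : Level) : Set (lsuc (c ⊔ ℓ₁ ⊔ ℓ₂)) where
  field
    commRing : CommutativeRing c ℓ₁
  open CommutativeRing commRing public
  field
    _≤_          : Rel Carrier ℓ₂
    isTotalOrder : IsTotalOrder _≈_ _≤_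
    +-mono-≤     : ∀ {a b} d → a ≤ b → (a + d) ≤ (b + d)
    *-nonneg     : ∀ {a b} → 0# ≤ a → 0# ≤ b → 0# ≤ (a * b)
    0≉1          : ¬ (0# ≈ 1#)
    inverse      : ∀ a → ¬ (a ≈ 0#) → ∃ λ b → (a * b) ≈ 1#
    lub          : (P : Carrier → Set c) → ∃ P →
                   (∃ λ u → ∀ x → P x → x ≤ u) →
                   ∃ λ s → (∀ x → P x → x ≤ s) ×
                           (∀ u → (∀ x → P x → x ≤ u) → s ≤ u)

  _<_ : Rel Carrier (ℓ₁ ⊔ ℓ₂)
  a < b = (a ≤ b) × ¬ (a ≈ b)

module LP {c ℓ₁ ℓ₂ : Level} (R : RealNumbers c ℓ₁ ℓ₂) where
  open RealNumbers R

  -- A Laurent polynomial sum_i c_i x^i: a coefficient function together with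
  -- a bound N such that c_i = 0 whenever |i| > N (see IsLaurent).
  record LaurentPoly : Set c where
    constructor mkLP
    field
      coeff : ℤ → Carrier
      bound : ℕ
  open LaurentPoly public

  IsLaurent : LaurentPoly → Set (ℓ₁)
  IsLaurent f = ∀ i → bound f ℕ.< ∣ i ∣ → coeff f i ≈ 0#

  symRange : ℕ → List ℤ
  symRange N = map (λ k → (+ k) ℤ.- (+ N)) (upTo (ℕ.suc (2 ℕ.* N)))

  sumL : List Carrier → Carrier
  sumL = foldr _+_ 0#

  0ₗ : LaurentPoly
  0ₗ = mkLP (λ _ → 0#) 0

  1ₗ : LaurentPoly
  1ₗ = mkLP (λ i → case0 i) 0
    where
    case0 : ℤ → Carrier
    case0 i with i ℤ.≟ + 0
    ... | yes _ = 1#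
    ... | no  _ = 0#

  _+ₗ_ : LaurentPoly → LaurentPoly → LaurentPoly
  f +ₗ g = mkLP (λ i → coeff f i + coeff g i) (bound f ℕ.⊔ bound g)

  _*ₗ_ : LaurentPoly → LaurentPoly → LaurentPoly
  f *ₗ g = mkLP (λ k → sumL (map (λ i → coeff f i * coeff g (k ℤ.- i)) (symRange (bound f))))
                (bound f ℕ.+ bound g)

  U : ℕ → LaurentPoly → Set (ℓ₁ ⊔ ℓ₂)
  U ν f = IsLaurent f
        × (∀ i → 0# ≤ coeff f i)
        × (∀ i → coeff f (ℤ.- i) ≈ coeff f i)
        × (∀ r ℓ → r ℕ.< ν →
             coeff f (+ (r ℕ.+ ℓ ℕ.* ν)) ≥' coeff f (+ (r ℕ.+ ℕ.suc ℓ ℕ.* ν)))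
    where
    _≥'_ : Carrier → Carrier → Set ℓ₂
    a ≥' b = b ≤ a

  T : ℕ → LaurentPoly → Set (ℓ₁ ⊔ ℓ₂)
  T ν f = U ν f
        × (∀ r ℓ → r ℕ.< ν →
             0# < coeff f (+ (r ℕ.+ ℓ ℕ.* ν)) →
             coeff f (+ (r ℕ.+ ℕ.suc ℓ ℕ.* ν)) < coeff f (+ (r ℕ.+ ℓ ℕ.* ν)))

  IsSubSemiring : (LaurentPoly → Set (ℓ₁ ⊔ ℓ₂)) → Set (c ⊔ ℓ₁ ⊔ ℓ₂)
  IsSubSemiring S = S 0ₗ × S 1ₗ
                  × (∀ f g → S f → S g → S (f +ₗ g))
                  × (∀ f g → S f → S g → S (f *ₗ g))

open LP public using (LaurentPoly; mkLP; IsLaurent; U; T; IsSubSemiring; _+ₗ_; _*ₗ_; 0ₗ; 1ₗ)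

{-# OPTIONS --safe #-}
-- Closure under 0, 1 and + is immediate, as are the support bound, nonnegativity and symmetry of a
-- product h = f g.  Monotonicity of h along steps of ν comes from pairing: with K = k, K′ = k + ν,
-- reindexing the convolution by i ↦ K + K′ − i gives
--   2 (h_K − h_K′) = Σ_i (f_i − f_(K+K′−i)) (g_(K−i) − g_(K′−i)).
-- The summand is invariant under the reindexing, and when 2i ≤ K + K′ both factors are ≥ 0: the
-- indices K + K′ − i and K′ − i are at least as far from 0 as i and K − i, in the same residue class
-- mod ν because ν ∣ 2.  For strict monotonicity, h_K′ = h_K forces every summand to vanish, whereas a
-- nonzero term f_i g_(K−i) of h_K yields an index below the centre whose summand is a product of two
-- nonzero differences.
module Submission where

open import Level using (Level)
open import Data.Nat as ℕ using (ℕ; zero; suc)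
open import Data.Nat.Properties as ℕ using ()
open import Data.Nat.DivMod using (_%_; _/_; m≡m%n+[m/n]*n; m%n<n)
open import Data.Nat.Divisibility as ℕ using (divides)
open import Data.Integer as ℤ using (ℤ; +_; ∣_∣; 0ℤ)
open import Data.Integer.Properties as ℤ using ()
open import Data.Integer.Divisibility.Signed as ℤ using (∣⇒∣ᵤ)
open import Data.Integer.Tactic.RingSolver using (solve-∀)
open import Data.List using (applyUpTo; map)
open import Data.List.Properties using (map-applyUpTo)
open import Data.Product using (_×_; ∃-syntax; _,_; proj₁; proj₂)
open import Data.Sum using (_⊎_; inj₁; inj₂; [_,_])
open import Data.Empty using (⊥-elim)
open import Relation.Nullary using (¬_; yes; no)
open import Relation.Binary.Bundles using (Poset)
open import Relation.Binary.Structures using (IsTotalOrder)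
open import Relation.Binary.PropositionalEquality as ≡ using (_≡_; cong; cong₂)
open import Function using (_∘_; id)
open import Defs hiding (0ₗ; 1ₗ; _+ₗ_; _*ₗ_)

i<j⇒0<j-i : ∀ {i j} → i ℤ.< j → 0ℤ ℤ.< j ℤ.- i
i<j⇒0<j-i {i} {j} i<j = ≡.subst (ℤ._< j ℤ.- i) (ℤ.+-inverseʳ i) (ℤ.+-monoˡ-< (ℤ.- i) i<j)

0<j-i⇒i<j : ∀ {i j} → 0ℤ ℤ.< j ℤ.- i → i ℤ.< j
0<j-i⇒i<j {i} {j} 0<j-i = ≡.subst₂ ℤ._<_ (ℤ.+-identityʳ i) (i+[j-i]≡j i j) (ℤ.+-monoʳ-< i 0<j-i)
  where
  i+[j-i]≡j : ∀ i j → i ℤ.+ (j ℤ.- i) ≡ j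
  i+[j-i]≡j = solve-∀

∣i∣≤n⇒0≤i+n : ∀ {i n} → ∣ i ∣ ℕ.≤ n → 0ℤ ℤ.≤ i ℤ.+ + n
∣i∣≤n⇒0≤i+n {+ m}          _     = ℤ.+≤+ ℕ.z≤n
∣i∣≤n⇒0≤i+n {ℤ.-[1+ m ]} 1+m≤n = ≡.subst (0ℤ ℤ.≤_) (≡.sym (ℤ.⊖-≥ 1+m≤n)) (ℤ.+≤+ ℕ.z≤n)

∣2⇒nonZero : ∀ {ν} → ν ℕ.∣ 2 → ℕ.NonZero ν
∣2⇒nonZero {zero} 0∣2 with ℕ.0∣⇒≡0 0∣2
... | ()
∣2⇒nonZero {suc ν} _ = _

module _ (ν : ℕ) {p} (P : ℕ → ℕ → Set p) where

  private
    r+[1+ℓ]ν≡r+ℓν+ν : ∀ r ℓ → r ℕ.+ suc ℓ ℕ.* ν ≡ r ℕ.+ ℓ ℕ.* ν ℕ.+ ν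
    r+[1+ℓ]ν≡r+ℓν+ν r ℓ =
      ≡.trans (cong (r ℕ.+_) (ℕ.+-comm ν (ℓ ℕ.* ν))) (≡.sym (ℕ.+-assoc r (ℓ ℕ.* ν) ν))

  residueSteps⇒steps : .{{_ : ℕ.NonZero ν}} →
                       (∀ r ℓ → r ℕ.< ν → P (r ℕ.+ ℓ ℕ.* ν) (r ℕ.+ suc ℓ ℕ.* ν)) →
                       ∀ n → P n (n ℕ.+ ν)
  residueSteps⇒steps steps n = ≡.subst₂ P (≡.sym n≡r+qν)
    (≡.trans (r+[1+ℓ]ν≡r+ℓν+ν (n % ν) (n / ν)) (cong (ℕ._+ ν) (≡.sym n≡r+qν)))
    (steps (n % ν) (n / ν) (m%n<n n ν))
    where
    n≡r+qν : n ≡ n % ν ℕ.+ (n / ν) ℕ.* ν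
    n≡r+qν = m≡m%n+[m/n]*n n ν

  steps⇒residueSteps : (∀ n → P n (n ℕ.+ ν)) →
                       ∀ r ℓ → r ℕ.< ν → P (r ℕ.+ ℓ ℕ.* ν) (r ℕ.+ suc ℓ ℕ.* ν)
  steps⇒residueSteps step r ℓ _ =
    ≡.subst (P _) (≡.sym (r+[1+ℓ]ν≡r+ℓν+ν r ℓ)) (step (r ℕ.+ ℓ ℕ.* ν))

module ResidueOrder (ν : ℕ) where

  infix 4 _≼_ _≺_

  data _≼_ (u v : ℤ) : Set where
    outward : ∀ n → ∣ v ∣ ≡ ∣ u ∣ ℕ.+ n ℕ.* ν → u ≼ v

  data _≺_ (u v : ℤ) : Set where
    outward⁺ : ∀ n → ∣ v ∣ ≡ ∣ u ∣ ℕ.+ suc n ℕ.* ν → u ≺ v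

  private
    v≡u+[v-u] : ∀ u v → v ≡ u ℤ.+ (v ℤ.- u)
    v≡u+[v-u] = solve-∀

    v≡-u+[v+u] : ∀ u v → v ≡ ℤ.- u ℤ.+ (v ℤ.+ u)
    v≡-u+[v+u] = solve-∀

    v≡∣u∣+gap : ∀ u v → v ≡ + ∣ u ∣ ℤ.+ (v ℤ.- u) ⊎ v ≡ + ∣ u ∣ ℤ.+ (v ℤ.+ u)
    v≡∣u∣+gap u v with ℤ.+∣i∣≡i⊎+∣i∣≡-i u
    ... | inj₁ ∣u∣≡u  = inj₁ (≡.trans (v≡u+[v-u] u v) (cong (ℤ._+ (v ℤ.- u)) (≡.sym ∣u∣≡u)))
    ... | inj₂ ∣u∣≡-u = inj₂ (≡.trans (v≡-u+[v+u] u v) (cong (ℤ._+ (v ℤ.+ u)) (≡.sym ∣u∣≡-u)))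

    ∣v∣≡∣u∣+∣w∣ : ∀ u {v w} → v ≡ + ∣ u ∣ ℤ.+ w → 0ℤ ℤ.≤ w → ∣ v ∣ ≡ ∣ u ∣ ℕ.+ ∣ w ∣
    ∣v∣≡∣u∣+∣w∣ u ≡.refl 0≤w = cong (λ x → ∣ + ∣ u ∣ ℤ.+ x ∣) (≡.sym (ℤ.0≤i⇒+∣i∣≡i 0≤w))

    ≼-gap : ∀ u {v w} → v ≡ + ∣ u ∣ ℤ.+ w → 0ℤ ℤ.≤ w → + ν ℤ.∣ w → u ≼ v
    ≼-gap u v≡ 0≤w ν∣w with ∣⇒∣ᵤ ν∣w
    ... | divides q ∣w∣≡qν = outward q (≡.trans (∣v∣≡∣u∣+∣w∣ u v≡ 0≤w) (cong (∣ u ∣ ℕ.+_) ∣w∣≡qν))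

    ≺-gap : ∀ u {v w} → v ≡ + ∣ u ∣ ℤ.+ w → 0ℤ ℤ.< w → + ν ℤ.∣ w → u ≺ v
    ≺-gap u v≡ 0<w ν∣w with ∣⇒∣ᵤ ν∣w
    ... | divides (suc q) ∣w∣≡qν =
      outward⁺ q (≡.trans (∣v∣≡∣u∣+∣w∣ u v≡ (ℤ.<⇒≤ 0<w)) (cong (∣ u ∣ ℕ.+_) ∣w∣≡qν))
    ... | divides zero    ∣w∣≡0  = ⊥-elim (ℤ.<-irrefl (≡.sym (ℤ.∣i∣≡0⇒i≡0 ∣w∣≡0)) 0<w)

  ≼-intro : ∀ {u v d s} → v ℤ.- u ≡ d → v ℤ.+ u ≡ s →
            0ℤ ℤ.≤ d → 0ℤ ℤ.≤ s → + ν ℤ.∣ d → + ν ℤ.∣ s → u ≼ v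
  ≼-intro {u} {v} ≡.refl ≡.refl 0≤d 0≤s ν∣d ν∣s with v≡∣u∣+gap u v
  ... | inj₁ v≡ = ≼-gap u v≡ 0≤d ν∣d
  ... | inj₂ v≡ = ≼-gap u v≡ 0≤s ν∣s

  ≺-intro : ∀ {u v d s} → v ℤ.- u ≡ d → v ℤ.+ u ≡ s →
            0ℤ ℤ.< d → 0ℤ ℤ.< s → + ν ℤ.∣ d → + ν ℤ.∣ s → u ≺ v
  ≺-intro {u} {v} ≡.refl ≡.refl 0<d 0<s ν∣d ν∣s with v≡∣u∣+gap u v
  ... | inj₁ v≡ = ≺-gap u v≡ 0<d ν∣d
  ... | inj₂ v≡ = ≺-gap u v≡ 0<s ν∣s

-- Indices for comparing the coefficients at K = k and K′ = k + ν of a product through the pairing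
-- i ↦ K + K′ − i.  Since ν ∣ 2, every 2x + ν is a multiple of ν, which keeps paired indices in one
-- residue class mod ν.
module ConvolutionIndices {ν : ℕ} (ν∣2 : ν ℕ.∣ 2) (k : ℕ) where
  open ResidueOrder ν

  private instance
    ν-nonZero : ℕ.NonZero ν
    ν-nonZero = ∣2⇒nonZero ν∣2

  K K′ : ℤ
  K  = + k
  K′ = + k ℤ.+ + ν

  private
    ν∣x+x : ∀ x → + ν ℤ.∣ x ℤ.+ x
    ν∣x+x x = ℤ.∣-trans (ℤ.∣ᵤ⇒∣ ν∣2) (ℤ.divides x (x+x≡x*2 x))
      where
      x+x≡x*2 : ∀ x → x ℤ.+ x ≡ x ℤ.* + 2
      x+x≡x*2 = solve-∀

    ν∣x+x+ν : ∀ x → + ν ℤ.∣ x ℤ.+ x ℤ.+ + ν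
    ν∣x+x+ν x = ℤ.∣m∣n⇒∣m+n (ν∣x+x x) ℤ.∣-refl

    0<ν : 0ℤ ℤ.< + ν
    0<ν = ℤ.+<+ (ℕ.>-nonZero⁻¹ ν)

    0<K+K′ : 0ℤ ℤ.< K ℤ.+ K′
    0<K+K′ = ℤ.+-mono-≤-< (ℤ.+≤+ (ℕ.z≤n {k}))
                          (ℤ.+<+ (ℕ.<-≤-trans (ℕ.>-nonZero⁻¹ ν) (ℕ.m≤n+m ν k)))

    [s-i]-i≡s-[i+i] : ∀ s i → s ℤ.- i ℤ.- i ≡ s ℤ.- (i ℤ.+ i)
    [s-i]-i≡s-[i+i] = solve-∀

    [s-i]+i≡s : ∀ s i → s ℤ.- i ℤ.+ i ≡ s
    [s-i]+i≡s = solve-∀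

    [K+[K+ν]]-[i+i] : ∀ K ν i → K ℤ.+ (K ℤ.+ ν) ℤ.- (i ℤ.+ i) ≡ (K ℤ.- i) ℤ.+ (K ℤ.- i) ℤ.+ ν
    [K+[K+ν]]-[i+i] = solve-∀

    [K+ν-i]-[K-i]≡ν : ∀ K ν i → K ℤ.+ ν ℤ.- i ℤ.- (K ℤ.- i) ≡ ν
    [K+ν-i]-[K-i]≡ν = solve-∀

    [K+ν-i]+[K-i] : ∀ K ν i → K ℤ.+ ν ℤ.- i ℤ.+ (K ℤ.- i) ≡ K ℤ.+ (K ℤ.+ ν) ℤ.- (i ℤ.+ i)
    [K+ν-i]+[K-i] = solve-∀

    s-[[s-i]+[s-i]] : ∀ s i → s ℤ.- ((s ℤ.- i) ℤ.+ (s ℤ.- i)) ≡ i ℤ.+ i ℤ.- s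
    s-[[s-i]+[s-i]] = solve-∀

    i-[K+K-i] : ∀ K i → i ℤ.- (K ℤ.+ K ℤ.- i) ≡ (i ℤ.- K) ℤ.+ (i ℤ.- K)
    i-[K+K-i] = solve-∀

    i-[K+K-i]′ : ∀ K ν i → i ℤ.- (K ℤ.+ K ℤ.- i) ≡ i ℤ.+ i ℤ.- (K ℤ.+ (K ℤ.+ ν)) ℤ.+ ν
    i-[K+K-i]′ = solve-∀

    i+[K+K-i] : ∀ K i → i ℤ.+ (K ℤ.+ K ℤ.- i) ≡ K ℤ.+ K
    i+[K+K-i] = solve-∀

    [K+[K+ν]]-2[K+K-i] : ∀ K ν i → K ℤ.+ (K ℤ.+ ν) ℤ.- ((K ℤ.+ K ℤ.- i) ℤ.+ (K ℤ.+ K ℤ.- i))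
                                 ≡ i ℤ.+ i ℤ.- (K ℤ.+ (K ℤ.+ ν)) ℤ.+ (ν ℤ.+ ν)
    [K+[K+ν]]-2[K+K-i] = solve-∀

    K-[K+K-i] : ∀ K i → K ℤ.- (K ℤ.+ K ℤ.- i) ≡ ℤ.- (K ℤ.- i)
    K-[K+K-i] = solve-∀

    ν∣K+K′-[i+i] : ∀ i → + ν ℤ.∣ K ℤ.+ K′ ℤ.- (i ℤ.+ i)
    ν∣K+K′-[i+i] i = ≡.subst (+ ν ℤ.∣_) (≡.sym ([K+[K+ν]]-[i+i] K (+ ν) i)) (ν∣x+x+ν (K ℤ.- i))

    ν∣K+K′ : + ν ℤ.∣ K ℤ.+ K′
    ν∣K+K′ = ≡.subst (+ ν ℤ.∣_) (ℤ.+-assoc K K (+ ν)) (ν∣x+x+ν K)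

  reflect-≼ : ∀ {i} → i ℤ.+ i ℤ.≤ K ℤ.+ K′ → i ≼ K ℤ.+ K′ ℤ.- i
  reflect-≼ {i} 2i≤S = ≼-intro ([s-i]-i≡s-[i+i] (K ℤ.+ K′) i) ([s-i]+i≡s (K ℤ.+ K′) i)
    (ℤ.i≤j⇒0≤j-i 2i≤S) (ℤ.+≤+ ℕ.z≤n) (ν∣K+K′-[i+i] i) ν∣K+K′

  reflect-≺ : ∀ {i} → i ℤ.+ i ℤ.< K ℤ.+ K′ → i ≺ K ℤ.+ K′ ℤ.- i
  reflect-≺ {i} 2i<S = ≺-intro ([s-i]-i≡s-[i+i] (K ℤ.+ K′) i) ([s-i]+i≡s (K ℤ.+ K′) i)
    (i<j⇒0<j-i 2i<S) 0<K+K′ (ν∣K+K′-[i+i] i) ν∣K+K′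

  shift-≼ : ∀ {i} → i ℤ.+ i ℤ.≤ K ℤ.+ K′ → K ℤ.- i ≼ K′ ℤ.- i
  shift-≼ {i} 2i≤S = ≼-intro ([K+ν-i]-[K-i]≡ν K (+ ν) i) ([K+ν-i]+[K-i] K (+ ν) i)
    (ℤ.+≤+ ℕ.z≤n) (ℤ.i≤j⇒0≤j-i 2i≤S) ℤ.∣-refl (ν∣K+K′-[i+i] i)

  shift-≺ : ∀ {i} → i ℤ.+ i ℤ.< K ℤ.+ K′ → K ℤ.- i ≺ K′ ℤ.- i
  shift-≺ {i} 2i<S = ≺-intro ([K+ν-i]-[K-i]≡ν K (+ ν) i) ([K+ν-i]+[K-i] K (+ ν) i)
    0<ν (i<j⇒0<j-i 2i<S) ℤ.∣-refl (ν∣K+K′-[i+i] i)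

  reflect-lower : ∀ {i} → K ℤ.+ K′ ℤ.≤ i ℤ.+ i →
                  (K ℤ.+ K′ ℤ.- i) ℤ.+ (K ℤ.+ K′ ℤ.- i) ℤ.≤ K ℤ.+ K′
  reflect-lower {i} S≤2i =
    ℤ.0≤i-j⇒j≤i (≡.subst (0ℤ ℤ.≤_) (≡.sym (s-[[s-i]+[s-i]] (K ℤ.+ K′) i)) (ℤ.i≤j⇒0≤j-i S≤2i))

  mirror-≼ : ∀ {i} → K ℤ.+ K′ ℤ.≤ i ℤ.+ i → K ℤ.+ K ℤ.- i ≼ i
  mirror-≼ {i} S≤2i = ≼-intro (i-[K+K-i] K i) (i+[K+K-i] K i)
    (≡.subst (0ℤ ℤ.≤_) (≡.trans (≡.sym (i-[K+K-i]′ K (+ ν) i)) (i-[K+K-i] K i))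
      (ℤ.+-mono-≤ (ℤ.i≤j⇒0≤j-i S≤2i) (ℤ.+≤+ ℕ.z≤n)))
    (ℤ.+≤+ ℕ.z≤n) (ν∣x+x (i ℤ.- K)) (ν∣x+x K)

  mirror-lower : ∀ {i} → K ℤ.+ K′ ℤ.≤ i ℤ.+ i →
                 (K ℤ.+ K ℤ.- i) ℤ.+ (K ℤ.+ K ℤ.- i) ℤ.< K ℤ.+ K′
  mirror-lower {i} S≤2i = 0<j-i⇒i<j (≡.subst (0ℤ ℤ.<_) (≡.sym ([K+[K+ν]]-2[K+K-i] K (+ ν) i))
    (ℤ.+-mono-≤-< (ℤ.i≤j⇒0≤j-i S≤2i) (ℤ.+-mono-< 0<ν 0<ν)))

  K-mirror : ∀ i → K ℤ.- (K ℤ.+ K ℤ.- i) ≡ ℤ.- (K ℤ.- i)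
  K-mirror = K-[K+K-i] K

module _ {a ℓ₁ ℓ₂ : Level} (R : RealNumbers a ℓ₁ ℓ₂) where

  open RealNumbers R
  open LP R using (coeff; bound; sumL; 0ₗ; 1ₗ; _+ₗ_; _*ₗ_)
  open IsTotalOrder isTotalOrder using (total; antisym; isPartialOrder; ≤-respˡ-≈; ≤-respʳ-≈)
    renaming (refl to ≤-refl; reflexive to ≤-reflexive)
  open import Algebra.Properties.Ring ring
    using (-‿distribˡ-*; -‿distribʳ-*; -1*x≈-x; x[y-z]≈xy-xz; [y-z]x≈yx-zx)
  open import Algebra.Properties.AbelianGroup +-abelianGroup
    using (⁻¹-involutive; ε⁻¹≈ε; ⁻¹-∙-comm; x∙y⁻¹≈ε⇒x≈y; x≈y⇒x∙y⁻¹≈ε; ⁻¹-anti-homo‿-)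
  open import Algebra.Properties.CommutativeSemigroup *-commutativeSemigroup
    using () renaming (interchange to *-interchange)
  open import Algebra.Properties.CommutativeSemigroup +-commutativeSemigroup
    using () renaming (interchange to +-interchange)

  ≤-poset : Poset a ℓ₁ ℓ₂
  ≤-poset = record { isPartialOrder = isPartialOrder }

  open import Relation.Binary.Reasoning.PartialOrder ≤-poset
    using (begin_; begin-equality_; step-≤; step-≈-⟩; step-≈-⟨; step-≡-⟩; step-≡-⟨; _∎)

  ≡→≈ : ∀ {x y} → x ≡ y → x ≈ y
  ≡→≈ ≡.refl = refl

  +-mono₂-≤ : ∀ {a b x y} → a ≤ b → x ≤ y → (a + x) ≤ (b + y)
  +-mono₂-≤ {a} {b} {x} {y} a≤b x≤y = begin
    a + x ≤⟨ +-mono-≤ x a≤b ⟩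
    b + x ≈⟨ +-comm b x ⟩
    x + b ≤⟨ +-mono-≤ b x≤y ⟩
    y + b ≈⟨ +-comm y b ⟩
    b + y ∎

  x≤y⇒0≤y-x : ∀ {x y} → x ≤ y → 0# ≤ (y - x)
  x≤y⇒0≤y-x {x} {y} x≤y = begin
    0#    ≈⟨ -‿inverseʳ x ⟨
    x - x ≤⟨ +-mono-≤ (- x) x≤y ⟩
    y - x ∎

  0≤y-x⇒x≤y : ∀ {x y} → 0# ≤ (y - x) → x ≤ y
  0≤y-x⇒x≤y {x} {y} 0≤y-x = begin
    x             ≈⟨ +-identityˡ x ⟨
    0# + x        ≤⟨ +-mono-≤ x 0≤y-x ⟩
    y - x + x     ≈⟨ +-assoc y (- x) x ⟩
    y + (- x + x) ≈⟨ +-congˡ (-‿inverseˡ x) ⟩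
    y + 0#        ≈⟨ +-identityʳ y ⟩
    y             ∎

  x≉y⇒x-y≉0 : ∀ {x y} → x ≉ y → x - y ≉ 0#
  x≉y⇒x-y≉0 x≉y x-y≈0 = x≉y (x∙y⁻¹≈ε⇒x≈y _ _ x-y≈0)

  0≤x⇒0≤y⇒0≤x+y : ∀ {x y} → 0# ≤ x → 0# ≤ y → 0# ≤ (x + y)
  0≤x⇒0≤y⇒0≤x+y 0≤x 0≤y = ≤-respˡ-≈ (+-identityˡ 0#) (+-mono₂-≤ 0≤x 0≤y)

  0≤x+x⇒0≤x : ∀ {x} → 0# ≤ (x + x) → 0# ≤ x
  0≤x+x⇒0≤x {x} 0≤x+x with total 0# x
  ... | inj₁ 0≤x = 0≤x
  ... | inj₂ x≤0 = begin
    0#     ≤⟨ 0≤x+x ⟩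
    x + x  ≤⟨ +-mono-≤ x x≤0 ⟩
    0# + x ≈⟨ +-identityˡ x ⟩
    x      ∎

  x+y≈0⇒x≈0 : ∀ {x y} → 0# ≤ x → 0# ≤ y → x + y ≈ 0# → x ≈ 0#
  x+y≈0⇒x≈0 {x} {y} 0≤x 0≤y x+y≈0 = antisym (begin
    x      ≈⟨ +-identityʳ x ⟨
    x + 0# ≤⟨ +-mono₂-≤ ≤-refl 0≤y ⟩
    x + y  ≈⟨ x+y≈0 ⟩
    0#     ∎) 0≤x

  x′≤x⇒y′≤y⇒x′+y′≈x+y⇒x′≈x : ∀ {x x′ y y′} → x′ ≤ x → y′ ≤ y → x′ + y′ ≈ x + y → x′ ≈ x
  x′≤x⇒y′≤y⇒x′+y′≈x+y⇒x′≈x {x} {x′} {y} {y′} x′≤x y′≤y x′+y′≈x+y =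
    sym (x∙y⁻¹≈ε⇒x≈y x x′ (x+y≈0⇒x≈0 (x≤y⇒0≤y-x x′≤x) (x≤y⇒0≤y-x y′≤y) (begin-equality
      (x - x′) + (y - y′)   ≈⟨ +-interchange x (- x′) y (- y′) ⟩
      (x + y) + (- x′ - y′) ≈⟨ +-congˡ (⁻¹-∙-comm x′ y′) ⟩
      (x + y) - (x′ + y′)   ≈⟨ x≈y⇒x∙y⁻¹≈ε (sym x′+y′≈x+y) ⟩
      0#                    ∎)))

  y≈0⇒0<x⇒y<x : ∀ {x y} → y ≈ 0# → 0# < x → y < x
  y≈0⇒0<x⇒y<x y≈0 (0≤x , 0≉x) = ≤-respˡ-≈ (sym y≈0) 0≤x , 0≉x ∘ trans (sym y≈0)

  0≤1 : 0# ≤ 1#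
  0≤1 with total 0# 1#
  ... | inj₁ 0≤1 = 0≤1
  ... | inj₂ 1≤0 = ≤-respʳ-≈ -1*-1≈1 (*-nonneg 0≤-1 0≤-1)
    where
    0≤-1 : 0# ≤ (- 1#)
    0≤-1 = ≤-respʳ-≈ (+-identityˡ (- 1#)) (x≤y⇒0≤y-x 1≤0)
    -1*-1≈1 : - 1# * - 1# ≈ 1#
    -1*-1≈1 = trans (-1*x≈-x (- 1#)) (⁻¹-involutive 1#)

  x≉0⇒y≉0⇒x*y≉0 : ∀ {x y} → x ≉ 0# → y ≉ 0# → x * y ≉ 0#
  x≉0⇒y≉0⇒x*y≉0 {x} {y} x≉0 y≉0 xy≈0 with inverse x x≉0 | inverse y y≉0
  ... | x⁻¹ , xx⁻¹≈1 | y⁻¹ , yy⁻¹≈1 = 0≉1 (begin-equality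
    0#                  ≈⟨ zeroˡ (x⁻¹ * y⁻¹) ⟨
    0# * (x⁻¹ * y⁻¹)    ≈⟨ *-congʳ xy≈0 ⟨
    x * y * (x⁻¹ * y⁻¹) ≈⟨ *-interchange x y x⁻¹ y⁻¹ ⟩
    x * x⁻¹ * (y * y⁻¹) ≈⟨ *-cong xx⁻¹≈1 yy⁻¹≈1 ⟩
    1# * 1#             ≈⟨ *-identityˡ 1# ⟩
    1#                  ∎)

  -- Opaque, so that unification never unfolds a sum into its list representation.
  opaque
    ∑ : ℕ → (ℕ → Carrier) → Carrier
    ∑ n h = sumL (applyUpTo h n)

    ∑≡sumL : ∀ n h → ∑ n h ≡ sumL (applyUpTo h n)
    ∑≡sumL n h = ≡.refl

    ∑-cong : ∀ n {h h′} → (∀ {t} → t ℕ.< n → h t ≈ h′ t) → ∑ n h ≈ ∑ n h′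
    ∑-cong zero    h≈h′ = refl
    ∑-cong (suc n) h≈h′ = +-cong (h≈h′ ℕ.z<s) (∑-cong n (h≈h′ ∘ ℕ.s<s))

    ∑-zero : ∀ n {h} → (∀ {t} → t ℕ.< n → h t ≈ 0#) → ∑ n h ≈ 0#
    ∑-zero zero    h≈0 = refl
    ∑-zero (suc n) h≈0 = trans (+-cong (h≈0 ℕ.z<s) (∑-zero n (h≈0 ∘ ℕ.s<s))) (+-identityʳ 0#)

    ∑-extend : ∀ m k {h} → (∀ {t} → m ℕ.≤ t → h t ≈ 0#) → ∑ m h ≈ ∑ (m ℕ.+ k) h
    ∑-extend zero    k h≈0 = sym (∑-zero k (λ _ → h≈0 ℕ.z≤n))
    ∑-extend (suc m) k h≈0 = +-congˡ (∑-extend m k (h≈0 ∘ ℕ.s≤s))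

    ∑-distrib-+ : ∀ n h h′ → ∑ n (λ t → h t + h′ t) ≈ ∑ n h + ∑ n h′
    ∑-distrib-+ zero    h h′ = sym (+-identityˡ 0#)
    ∑-distrib-+ (suc n) h h′ = trans (+-congˡ (∑-distrib-+ n _ _)) (+-interchange _ _ _ _)

    ∑-distrib-neg : ∀ n h → ∑ n (λ t → - h t) ≈ - ∑ n h
    ∑-distrib-neg zero    h = sym ε⁻¹≈ε
    ∑-distrib-neg (suc n) h = trans (+-congˡ (∑-distrib-neg n _)) (⁻¹-∙-comm _ _)

    ∑-last : ∀ n h → ∑ (suc n) h ≈ ∑ n h + h n
    ∑-last zero    h = trans (+-identityʳ (h 0)) (sym (+-identityˡ (h 0)))
    ∑-last (suc n) h = trans (+-congˡ (∑-last n _)) (sym (+-assoc _ _ _))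

    ∑-reverse : ∀ n h → ∑ n h ≈ ∑ n (λ t → h (n ℕ.∸ suc t))
    ∑-reverse zero    h = refl
    ∑-reverse (suc n) h = trans (∑-last n h) (trans (+-congʳ (∑-reverse n h)) (+-comm _ _))

    ∑-nonneg : ∀ n {h} → (∀ {t} → t ℕ.< n → 0# ≤ h t) → 0# ≤ ∑ n h
    ∑-nonneg zero    0≤h = ≤-refl
    ∑-nonneg (suc n) 0≤h = 0≤x⇒0≤y⇒0≤x+y (0≤h ℕ.z<s) (∑-nonneg n (0≤h ∘ ℕ.s<s))

    ∑-nonneg-≈0 : ∀ n {h} → (∀ {t} → t ℕ.< n → 0# ≤ h t) → ∑ n h ≈ 0# → ∀ {t} → t ℕ.< n → h t ≈ 0#
    ∑-nonneg-≈0 (suc n) 0≤h ∑≈0 {zero}  _ = x+y≈0⇒x≈0 (0≤h ℕ.z<s) (∑-nonneg n (0≤h ∘ ℕ.s<s)) ∑≈0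
    ∑-nonneg-≈0 (suc n) 0≤h ∑≈0 {suc t} (ℕ.s<s t<n) = ∑-nonneg-≈0 n (0≤h ∘ ℕ.s<s)
      (x+y≈0⇒x≈0 (∑-nonneg n (0≤h ∘ ℕ.s<s)) (0≤h ℕ.z<s) (trans (+-comm _ _) ∑≈0)) t<n

    ∑-¬¬≈0 : ∀ n {h} → (∀ {t} → t ℕ.< n → ¬ ¬ h t ≈ 0#) → ¬ ¬ ∑ n h ≈ 0#
    ∑-¬¬≈0 zero    _     ∑≉0 = ∑≉0 refl
    ∑-¬¬≈0 (suc n) ¬¬h≈0 ∑≉0 =
      ¬¬h≈0 ℕ.z<s λ h₀≈0 → ∑-¬¬≈0 n (¬¬h≈0 ∘ ℕ.s<s) λ ∑≈0 →
        ∑≉0 (trans (+-cong h₀≈0 ∑≈0) (+-identityʳ 0#))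

  ∑-distrib-- : ∀ n h h′ → ∑ n (λ t → h t - h′ t) ≈ ∑ n h - ∑ n h′
  ∑-distrib-- n h h′ = trans (∑-distrib-+ n h (λ t → - h′ t)) (+-congˡ (∑-distrib-neg n h′))

  module Unimodal {ν} {f : LaurentPoly R} (f∈U : U R ν f) where
    open ResidueOrder ν

    private
      F : ℤ → Carrier
      F = coeff f

    coeff-nonneg : ∀ i → 0# ≤ F i
    coeff-nonneg = proj₁ (proj₂ f∈U)

    coeff-sym : ∀ i → F (ℤ.- i) ≈ F i
    coeff-sym = proj₁ (proj₂ (proj₂ f∈U))

    coeff-abs : ∀ i → F i ≈ F (+ ∣ i ∣)
    coeff-abs (+ n)      = refl
    coeff-abs ℤ.-[1+ n ] = coeff-sym (+ suc n)

    coeff-step : .{{_ : ℕ.NonZero ν}} → ∀ n → F (+ (n ℕ.+ ν)) ≤ F (+ n)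
    coeff-step = residueSteps⇒steps ν (λ a b → F (+ b) ≤ F (+ a)) (proj₂ (proj₂ (proj₂ f∈U)))

    coeff-steps : .{{_ : ℕ.NonZero ν}} → ∀ n m → F (+ (n ℕ.+ m ℕ.* ν)) ≤ F (+ n)
    coeff-steps n zero    = ≤-reflexive (≡→≈ (cong (F ∘ +_) (ℕ.+-identityʳ n)))
    coeff-steps n (suc m) = begin
      F (+ (n ℕ.+ (ν ℕ.+ m ℕ.* ν))) ≡⟨ cong (F ∘ +_) (ℕ.+-assoc n ν (m ℕ.* ν)) ⟨
      F (+ (n ℕ.+ ν ℕ.+ m ℕ.* ν))   ≤⟨ coeff-steps (n ℕ.+ ν) m ⟩
      F (+ (n ℕ.+ ν))               ≤⟨ coeff-step n ⟩
      F (+ n)                       ∎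

    coeff-antitone : .{{_ : ℕ.NonZero ν}} → ∀ {u v} → u ≼ v → F v ≤ F u
    coeff-antitone {u} {v} (outward m ∣v∣≡∣u∣+mν) = begin
      F v                       ≈⟨ coeff-abs v ⟩
      F (+ ∣ v ∣)               ≡⟨ cong (F ∘ +_) ∣v∣≡∣u∣+mν ⟩
      F (+ (∣ u ∣ ℕ.+ m ℕ.* ν)) ≤⟨ coeff-steps ∣ u ∣ m ⟩
      F (+ ∣ u ∣)               ≈⟨ coeff-abs u ⟨
      F u                       ∎

    coeff-≉0-inward : .{{_ : ℕ.NonZero ν}} → ∀ {u v} → u ≼ v → F v ≉ 0# → F u ≉ 0#
    coeff-≉0-inward u≼v Fv≉0 Fu≈0 =
      Fv≉0 (antisym (≤-respʳ-≈ Fu≈0 (coeff-antitone u≼v)) (coeff-nonneg _))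

  module StrictlyUnimodal {ν} {f : LaurentPoly R} (f∈T : T R ν f) where
    open ResidueOrder ν
    open Unimodal (proj₁ f∈T) public

    private
      F : ℤ → Carrier
      F = coeff f

    coeff-strict-step : .{{_ : ℕ.NonZero ν}} → ∀ n → F (+ n) ≉ 0# → F (+ (n ℕ.+ ν)) ≉ F (+ n)
    coeff-strict-step n Fn≉0 = proj₂ (strict-steps n (coeff-nonneg (+ n) , Fn≉0 ∘ sym))
      where
      strict-steps : ∀ n → 0# < F (+ n) → F (+ (n ℕ.+ ν)) < F (+ n)
      strict-steps = residueSteps⇒steps ν (λ a b → 0# < F (+ a) → F (+ b) < F (+ a)) (proj₂ f∈T)

    coeff-strictly-antitone : .{{_ : ℕ.NonZero ν}} → ∀ {u v} → F u ≉ 0# → u ≺ v → F v ≉ F u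
    coeff-strictly-antitone {u} {v} Fu≉0 (outward⁺ m ∣v∣≡∣u∣+[1+m]ν) Fv≈Fu =
      coeff-strict-step ∣ u ∣ (Fu≉0 ∘ trans (coeff-abs u)) (antisym (coeff-step ∣ u ∣) (begin
        F (+ ∣ u ∣)                     ≈⟨ trans Fv≈Fu (coeff-abs u) ⟨
        F v                             ≈⟨ coeff-abs v ⟩
        F (+ ∣ v ∣)                     ≡⟨ cong (F ∘ +_) ∣v∣≡∣u∣+ν+mν ⟩
        F (+ (∣ u ∣ ℕ.+ ν ℕ.+ m ℕ.* ν)) ≤⟨ coeff-steps (∣ u ∣ ℕ.+ ν) m ⟩
        F (+ (∣ u ∣ ℕ.+ ν))             ∎))
      where
      ∣v∣≡∣u∣+ν+mν : ∣ v ∣ ≡ ∣ u ∣ ℕ.+ ν ℕ.+ m ℕ.* ν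
      ∣v∣≡∣u∣+ν+mν = ≡.trans ∣v∣≡∣u∣+[1+m]ν (≡.sym (ℕ.+-assoc ∣ u ∣ ν (m ℕ.* ν)))

  module _ {ν : ℕ} where

    0ₗ∈U : U R ν 0ₗ
    0ₗ∈U = (λ _ _ → refl) , (λ _ → ≤-refl) , (λ _ → refl) , (λ _ _ _ → ≤-refl)

    0ₗ∈T : T R ν 0ₗ
    0ₗ∈T = 0ₗ∈U , λ _ _ _ 0<0 → ⊥-elim (proj₂ 0<0 refl)

    private
      1ₗ-laurent : ∀ i → 0 ℕ.< ∣ i ∣ → coeff 1ₗ i ≈ 0#
      1ₗ-laurent (+ suc n)  _ = refl
      1ₗ-laurent ℤ.-[1+ n ] _ = refl

      1ₗ-nonneg : ∀ i → 0# ≤ coeff 1ₗ i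
      1ₗ-nonneg (+ zero)   = 0≤1
      1ₗ-nonneg (+ suc n)  = ≤-refl
      1ₗ-nonneg ℤ.-[1+ n ] = ≤-refl

      1ₗ-sym : ∀ i → coeff 1ₗ (ℤ.- i) ≈ coeff 1ₗ i
      1ₗ-sym (+ zero)   = refl
      1ₗ-sym (+ suc n)  = refl
      1ₗ-sym ℤ.-[1+ n ] = refl

      1ₗ-beyond-first-step : ∀ r ℓ → r ℕ.< ν → coeff 1ₗ (+ (r ℕ.+ suc ℓ ℕ.* ν)) ≈ 0#
      1ₗ-beyond-first-step r ℓ (ℕ.s≤s _) = ≡→≈ (cong (coeff 1ₗ ∘ +_) (ℕ.+-suc r _))

    1ₗ∈U : U R ν 1ₗ
    1ₗ∈U = 1ₗ-laurent , 1ₗ-nonneg , 1ₗ-sym ,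
           λ r ℓ r<ν → ≤-respˡ-≈ (sym (1ₗ-beyond-first-step r ℓ r<ν)) (1ₗ-nonneg (+ (r ℕ.+ ℓ ℕ.* ν)))

    1ₗ∈T : T R ν 1ₗ
    1ₗ∈T = 1ₗ∈U , λ r ℓ r<ν → y≈0⇒0<x⇒y<x (1ₗ-beyond-first-step r ℓ r<ν)

    +ₗ∈U : ∀ {f g} → U R ν f → U R ν g → U R ν (f +ₗ g)
    +ₗ∈U {f} {g} (f-laurent , f-nonneg , f-sym , f-mono) (g-laurent , g-nonneg , g-sym , g-mono) =
      laurent , (λ i → 0≤x⇒0≤y⇒0≤x+y (f-nonneg i) (g-nonneg i)) , (λ i → +-cong (f-sym i) (g-sym i)) ,
      λ r ℓ r<ν → +-mono₂-≤ (f-mono r ℓ r<ν) (g-mono r ℓ r<ν)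
      where
      laurent : ∀ i → bound f ℕ.⊔ bound g ℕ.< ∣ i ∣ → coeff f i + coeff g i ≈ 0#
      laurent i N<∣i∣ = trans (+-cong (f-laurent i (ℕ.≤-<-trans (ℕ.m≤m⊔n _ _) N<∣i∣))
                                      (g-laurent i (ℕ.≤-<-trans (ℕ.m≤n⊔m _ _) N<∣i∣)))
                              (+-identityʳ 0#)

    +ₗ∈T : ∀ {f g} → T R ν f → T R ν g → T R ν (f +ₗ g)
    +ₗ∈T {f} {g} (f∈U , f-strict) (g∈U , g-strict) = +ₗ∈U f∈U g∈U , strict
      where
      flat⇒¬¬0≈ : ∀ {x x′} → 0# ≤ x → (0# < x → x′ < x) → x′ ≈ x → ¬ ¬ 0# ≈ x
      flat⇒¬¬0≈ 0≤x step x′≈x 0≉x = proj₂ (step (0≤x , 0≉x)) x′≈x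

      strict : ∀ r ℓ → r ℕ.< ν → 0# < coeff (f +ₗ g) (+ (r ℕ.+ ℓ ℕ.* ν)) →
               coeff (f +ₗ g) (+ (r ℕ.+ suc ℓ ℕ.* ν)) < coeff (f +ₗ g) (+ (r ℕ.+ ℓ ℕ.* ν))
      strict r ℓ r<ν (_ , 0≉a+b) = +-mono₂-≤ a′≤a b′≤b , λ a′+b′≈a+b →
        flat⇒¬¬0≈ (proj₁ (proj₂ f∈U) _) (f-strict r ℓ r<ν)
          (x′≤x⇒y′≤y⇒x′+y′≈x+y⇒x′≈x a′≤a b′≤b a′+b′≈a+b) λ 0≈a →
        flat⇒¬¬0≈ (proj₁ (proj₂ g∈U) _) (g-strict r ℓ r<ν)
          (x′≤x⇒y′≤y⇒x′+y′≈x+y⇒x′≈x b′≤b a′≤a (trans (+-comm _ _) (trans a′+b′≈a+b (+-comm _ _)))) λ 0≈b →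
        0≉a+b (trans (sym (+-identityʳ 0#)) (+-cong 0≈a 0≈b))
        where
        a′≤a : coeff f (+ (r ℕ.+ suc ℓ ℕ.* ν)) ≤ coeff f (+ (r ℕ.+ ℓ ℕ.* ν))
        a′≤a = proj₂ (proj₂ (proj₂ f∈U)) r ℓ r<ν
        b′≤b : coeff g (+ (r ℕ.+ suc ℓ ℕ.* ν)) ≤ coeff g (+ (r ℕ.+ ℓ ℕ.* ν))
        b′≤b = proj₂ (proj₂ (proj₂ g∈U)) r ℓ r<ν

  module Convolution {ν} {f g : LaurentPoly R} (f∈U : U R ν f) (g∈U : U R ν g) where

    private
      module f = Unimodal f∈U
      module g = Unimodal g∈U

      F G : ℤ → Carrier
      F = coeff f
      G = coeff g

      N : ℕ
      N = bound f

      2N≡N+N : 2 ℕ.* N ≡ N ℕ.+ N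
      2N≡N+N = cong (N ℕ.+_) (ℕ.+-identityʳ N)

    ι : ℕ → ℤ
    ι t = + t ℤ.- + N

    coeff-*ₗ : ∀ K → coeff (f *ₗ g) K ≡ ∑ (suc (2 ℕ.* N)) (λ t → F (ι t) * G (K ℤ.- ι t))
    coeff-*ₗ K = ≡.trans (cong sumL (≡.trans (cong (map summand) (map-applyUpTo id ι (suc (2 ℕ.* N))))
                                             (map-applyUpTo ι summand (suc (2 ℕ.* N)))))
                         (≡.sym (∑≡sumL _ _))
      where
      summand : ℤ → Carrier
      summand i = F i * G (K ℤ.- i)

    F∘ι-beyond : ∀ {t} → suc (2 ℕ.* N) ℕ.≤ t → F (ι t) ≈ 0#
    F∘ι-beyond {t} 2N<t = proj₁ f∈U (ι t) (ℕ.<-≤-trans (ℕ.m+n≤o⇒m≤o∸n (suc N) 1+N+N≤t) t∸N≤∣ιt∣)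
      where
      1+N+N≤t : suc N ℕ.+ N ℕ.≤ t
      1+N+N≤t = ≡.subst (ℕ._≤ t) (cong suc 2N≡N+N) 2N<t
      t∸N≤∣ιt∣ : t ℕ.∸ N ℕ.≤ ∣ ι t ∣
      t∸N≤∣ιt∣ = ℕ.≤-reflexive (≡.sym (cong ∣_∣ (≡.trans (ℤ.m-n≡m⊖n t N) (ℤ.⊖-≥ N≤t))))
        where
        N≤t : N ℕ.≤ t
        N≤t = ℕ.≤-trans (ℕ.m≤m+n N N) (ℕ.≤-trans (ℕ.n≤1+n _) 1+N+N≤t)

    ι-reflect : ∀ c {t} → t ℕ.≤ 2 ℕ.* N ℕ.+ c → ι (2 ℕ.* N ℕ.+ c ℕ.∸ t) ≡ + c ℤ.- ι t
    ι-reflect c {t} t≤2N+c =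
      ≡.trans (cong (ℤ._- + N) +[2N+c∸t]≡N+N+c-t) ([N+N+c-t]-N≡c-[t-N] (+ N) (+ c) (+ t))
      where
      +[2N+c∸t]≡N+N+c-t : + (2 ℕ.* N ℕ.+ c ℕ.∸ t) ≡ + N ℤ.+ + N ℤ.+ + c ℤ.- + t
      +[2N+c∸t]≡N+N+c-t = ≡.sym (≡.trans (cong (λ m → + (m ℕ.+ c) ℤ.- + t) (≡.sym 2N≡N+N))
                                         (≡.trans (ℤ.m-n≡m⊖n _ t) (ℤ.⊖-≥ t≤2N+c)))
      [N+N+c-t]-N≡c-[t-N] : ∀ N c t → N ℤ.+ N ℤ.+ c ℤ.- t ℤ.- N ≡ c ℤ.- (t ℤ.- N)
      [N+N+c-t]-N≡c-[t-N] = solve-∀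

    ι-onto-support : ∀ c {j} → F j ≉ 0# → ∃[ t ] (t ℕ.< suc (2 ℕ.* N ℕ.+ c) × ι t ≡ j)
    ι-onto-support c {j} Fj≉0 =
      ∣ j ℤ.+ + N ∣ ,
      ℕ.s≤s (ℕ.≤-trans (ℤ.∣i+j∣≤∣i∣+∣j∣ j (+ N))
            (ℕ.≤-trans (ℕ.+-monoˡ-≤ N ∣j∣≤N) (ℕ.≤-trans (ℕ.≤-reflexive (≡.sym 2N≡N+N)) (ℕ.m≤m+n _ c)))) ,
      ≡.trans (cong (ℤ._- + N) (ℤ.0≤i⇒+∣i∣≡i (∣i∣≤n⇒0≤i+n {j} ∣j∣≤N))) ([j+N]-N≡j j (+ N))
      where
      ∣j∣≤N : ∣ j ∣ ℕ.≤ N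
      ∣j∣≤N = ℕ.≮⇒≥ (λ N<∣j∣ → Fj≉0 (proj₁ f∈U j N<∣j∣))
      [j+N]-N≡j : ∀ j N → j ℤ.+ N ℤ.- N ≡ j
      [j+N]-N≡j = solve-∀

    coeff-*ₗ-window : ∀ K c → coeff (f *ₗ g) K ≈ ∑ (suc (2 ℕ.* N ℕ.+ c)) (λ t → F (ι t) * G (K ℤ.- ι t))
    coeff-*ₗ-window K c = trans (≡→≈ (coeff-*ₗ K))
      (∑-extend (suc (2 ℕ.* N)) c (λ 2N<t → trans (*-congʳ (F∘ι-beyond 2N<t)) (zeroˡ _)))

    ∑-reflect : ∀ c (φ : ℤ → Carrier) →
                ∑ (suc (2 ℕ.* N ℕ.+ c)) (φ ∘ ι) ≈ ∑ (suc (2 ℕ.* N ℕ.+ c)) (λ t → φ (+ c ℤ.- ι t))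
    ∑-reflect c φ = trans (∑-reverse _ (φ ∘ ι))
                          (∑-cong _ (λ t<L → ≡→≈ (cong φ (ι-reflect c (ℕ.≤-pred t<L)))))

    coeff-*ₗ-sym : ∀ K → coeff (f *ₗ g) (ℤ.- K) ≈ coeff (f *ₗ g) K
    coeff-*ₗ-sym K = begin-equality
      coeff (f *ₗ g) (ℤ.- K)
        ≈⟨ coeff-*ₗ-window (ℤ.- K) 0 ⟩
      ∑ L (λ t → F (ι t) * G (ℤ.- K ℤ.- ι t))
        ≈⟨ ∑-reflect 0 (λ i → F i * G (ℤ.- K ℤ.- i)) ⟩
      ∑ L (λ t → F (0ℤ ℤ.- ι t) * G (ℤ.- K ℤ.- (0ℤ ℤ.- ι t)))
        ≈⟨ ∑-cong L (λ _ → *-cong (F-neg _) (G-neg _)) ⟩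
      ∑ L (λ t → F (ι t) * G (K ℤ.- ι t))
        ≈⟨ coeff-*ₗ-window K 0 ⟨
      coeff (f *ₗ g) K
        ∎
      where
      L : ℕ
      L = suc (2 ℕ.* N ℕ.+ 0)
      0-i≡-i : ∀ i → 0ℤ ℤ.- i ≡ ℤ.- i
      0-i≡-i = solve-∀
      -K-[0-i]≡-[K-i] : ∀ K i → ℤ.- K ℤ.- (0ℤ ℤ.- i) ≡ ℤ.- (K ℤ.- i)
      -K-[0-i]≡-[K-i] = solve-∀
      F-neg : ∀ i → F (0ℤ ℤ.- i) ≈ F i
      F-neg i = trans (≡→≈ (cong F (0-i≡-i i))) (f.coeff-sym i)
      G-neg : ∀ i → G (ℤ.- K ℤ.- (0ℤ ℤ.- i)) ≈ G (K ℤ.- i)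
      G-neg i = trans (≡→≈ (cong G (-K-[0-i]≡-[K-i] K i))) (g.coeff-sym (K ℤ.- i))

    coeff-*ₗ-nonneg : ∀ K → 0# ≤ coeff (f *ₗ g) K
    coeff-*ₗ-nonneg K = ≤-respʳ-≈ (sym (≡→≈ (coeff-*ₗ K)))
      (∑-nonneg (suc (2 ℕ.* N)) (λ {t} _ → *-nonneg (f.coeff-nonneg (ι t)) (g.coeff-nonneg (K ℤ.- ι t))))

    coeff-*ₗ-laurent : ∀ K → N ℕ.+ bound g ℕ.< ∣ K ∣ → coeff (f *ₗ g) K ≈ 0#
    coeff-*ₗ-laurent K N+N′<∣K∣ =
      trans (≡→≈ (coeff-*ₗ K)) (∑-zero (suc (2 ℕ.* N)) (λ {t} _ → summand≈0 (ι t)))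
      where
      K≡i+[K-i] : ∀ K i → K ≡ i ℤ.+ (K ℤ.- i)
      K≡i+[K-i] = solve-∀
      summand≈0 : ∀ i → F i * G (K ℤ.- i) ≈ 0#
      summand≈0 i with bound g ℕ.<? ∣ K ℤ.- i ∣
      ... | yes N′<∣K-i∣ = trans (*-congˡ (proj₁ g∈U _ N′<∣K-i∣)) (zeroʳ _)
      ... | no  N′≮∣K-i∣ = trans (*-congʳ (proj₁ f∈U i N<∣i∣)) (zeroˡ _)
        where
        N<∣i∣ : N ℕ.< ∣ i ∣
        N<∣i∣ = ℕ.+-cancelʳ-< (bound g) N ∣ i ∣ (ℕ.<-≤-trans N+N′<∣K∣ (ℕ.≤-trans
          (ℕ.≤-reflexive (cong ∣_∣ (K≡i+[K-i] K i)))
          (ℕ.≤-trans (ℤ.∣i+j∣≤∣i∣+∣j∣ i (K ℤ.- i)) (ℕ.+-monoʳ-≤ ∣ i ∣ (ℕ.≮⇒≥ N′≮∣K-i∣)))))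

    pairing : ℤ → ℤ → ℤ → Carrier
    pairing K K′ i = (F i - F (K ℤ.+ K′ ℤ.- i)) * (G (K ℤ.- i) - G (K′ ℤ.- i))

    private
      K-[K+K′-i] : ∀ K K′ i → K ℤ.- (K ℤ.+ K′ ℤ.- i) ≡ ℤ.- (K′ ℤ.- i)
      K-[K+K′-i] = solve-∀

      K′-[K+K′-i] : ∀ K K′ i → K′ ℤ.- (K ℤ.+ K′ ℤ.- i) ≡ ℤ.- (K ℤ.- i)
      K′-[K+K′-i] = solve-∀

      K+K′-[K+K′-i] : ∀ K K′ i → K ℤ.+ K′ ℤ.- (K ℤ.+ K′ ℤ.- i) ≡ i
      K+K′-[K+K′-i] = solve-∀

    G-difference-antisym : ∀ K K′ i →
      G (K ℤ.- (K ℤ.+ K′ ℤ.- i)) - G (K′ ℤ.- (K ℤ.+ K′ ℤ.- i)) ≈ - (G (K ℤ.- i) - G (K′ ℤ.- i))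
    G-difference-antisym K K′ i = begin-equality
      G (K ℤ.- (K ℤ.+ K′ ℤ.- i)) - G (K′ ℤ.- (K ℤ.+ K′ ℤ.- i))
        ≡⟨ cong₂ (λ a b → G a - G b) (K-[K+K′-i] K K′ i) (K′-[K+K′-i] K K′ i) ⟩
      G (ℤ.- (K′ ℤ.- i)) - G (ℤ.- (K ℤ.- i))
        ≈⟨ +-cong (g.coeff-sym _) (-‿cong (g.coeff-sym _)) ⟩
      G (K′ ℤ.- i) - G (K ℤ.- i)
        ≈⟨ ⁻¹-anti-homo‿- (G (K ℤ.- i)) (G (K′ ℤ.- i)) ⟨
      - (G (K ℤ.- i) - G (K′ ℤ.- i))
        ∎

    pairing-reflect : ∀ K K′ i → pairing K K′ (K ℤ.+ K′ ℤ.- i) ≈ pairing K K′ i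
    pairing-reflect K K′ i = begin-equality
      (F (K ℤ.+ K′ ℤ.- i) - F (K ℤ.+ K′ ℤ.- (K ℤ.+ K′ ℤ.- i)))
        * (G (K ℤ.- (K ℤ.+ K′ ℤ.- i)) - G (K′ ℤ.- (K ℤ.+ K′ ℤ.- i)))
        ≈⟨ *-cong (+-congˡ (-‿cong (≡→≈ (cong F (K+K′-[K+K′-i] K K′ i)))))
                  (G-difference-antisym K K′ i) ⟩
      (F (K ℤ.+ K′ ℤ.- i) - F i) * - (G (K ℤ.- i) - G (K′ ℤ.- i))
        ≈⟨ -‿distribʳ-* _ _ ⟨
      - ((F (K ℤ.+ K′ ℤ.- i) - F i) * (G (K ℤ.- i) - G (K′ ℤ.- i)))
        ≈⟨ -‿distribˡ-* _ _ ⟩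
      - (F (K ℤ.+ K′ ℤ.- i) - F i) * (G (K ℤ.- i) - G (K′ ℤ.- i))
        ≈⟨ *-congʳ (⁻¹-anti-homo‿- _ _) ⟩
      pairing K K′ i
        ∎

    -- Reindex by i ↦ K + K′ − i over the window −N ≤ i ≤ N + c, which is symmetric about (K + K′)/2.
    coeff-*ₗ-double-difference : ∀ K K′ c → + c ≡ K ℤ.+ K′ →
      (coeff (f *ₗ g) K - coeff (f *ₗ g) K′) + (coeff (f *ₗ g) K - coeff (f *ₗ g) K′)
        ≈ ∑ (suc (2 ℕ.* N ℕ.+ c)) (λ t → pairing K K′ (ι t))
    coeff-*ₗ-double-difference K K′ c c≡K+K′ = begin-equality
      D + D
        ≈⟨ +-cong D≈∑Fe (trans D≈∑Fe ∑Fe≈-∑F̃e) ⟩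
      ∑ L (λ t → F (ι t) * e (ι t)) - ∑ L (λ t → F̃ (ι t) * e (ι t))
        ≈⟨ ∑-distrib-- L _ _ ⟨
      ∑ L (λ t → F (ι t) * e (ι t) - F̃ (ι t) * e (ι t))
        ≈⟨ ∑-cong L (λ _ → [y-z]x≈yx-zx _ _ _) ⟨
      ∑ L (λ t → pairing K K′ (ι t))
        ∎
      where
      L : ℕ
      L = suc (2 ℕ.* N ℕ.+ c)
      D : Carrier
      D = coeff (f *ₗ g) K - coeff (f *ₗ g) K′
      e : ℤ → Carrier
      e i = G (K ℤ.- i) - G (K′ ℤ.- i)
      F̃ : ℤ → Carrier
      F̃ i = F (K ℤ.+ K′ ℤ.- i)

      D≈∑Fe : D ≈ ∑ L (λ t → F (ι t) * e (ι t))
      D≈∑Fe = begin-equality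
        D
          ≈⟨ +-cong (coeff-*ₗ-window K c) (-‿cong (coeff-*ₗ-window K′ c)) ⟩
        ∑ L (λ t → F (ι t) * G (K ℤ.- ι t)) - ∑ L (λ t → F (ι t) * G (K′ ℤ.- ι t))
          ≈⟨ ∑-distrib-- L _ _ ⟨
        ∑ L (λ t → F (ι t) * G (K ℤ.- ι t) - F (ι t) * G (K′ ℤ.- ι t))
          ≈⟨ ∑-cong L (λ _ → x[y-z]≈xy-xz _ _ _) ⟨
        ∑ L (λ t → F (ι t) * e (ι t))
          ∎

      ∑Fe≈-∑F̃e : ∑ L (λ t → F (ι t) * e (ι t)) ≈ - ∑ L (λ t → F̃ (ι t) * e (ι t))
      ∑Fe≈-∑F̃e = begin-equality
        ∑ L (λ t → F (ι t) * e (ι t))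
          ≈⟨ ∑-reflect c (λ i → F i * e i) ⟩
        ∑ L (λ t → F (+ c ℤ.- ι t) * e (+ c ℤ.- ι t))
          ≡⟨ cong (λ s → ∑ L (λ t → F (s ℤ.- ι t) * e (s ℤ.- ι t))) c≡K+K′ ⟩
        ∑ L (λ t → F̃ (ι t) * e (K ℤ.+ K′ ℤ.- ι t))
          ≈⟨ ∑-cong L (λ _ → *-congˡ (G-difference-antisym K K′ _)) ⟩
        ∑ L (λ t → F̃ (ι t) * - e (ι t))
          ≈⟨ ∑-cong L (λ _ → -‿distribʳ-* _ _) ⟨
        ∑ L (λ t → - (F̃ (ι t) * e (ι t)))
          ≈⟨ ∑-distrib-neg L _ ⟩
        - ∑ L (λ t → F̃ (ι t) * e (ι t))
          ∎

    module Antitone (ν∣2 : ν ℕ.∣ 2) (k : ℕ) where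
      open ConvolutionIndices ν∣2 k public

      private instance
        ν-nonZero : ℕ.NonZero ν
        ν-nonZero = ∣2⇒nonZero ν∣2

      pairing-nonneg-lower : ∀ {i} → i ℤ.+ i ℤ.≤ K ℤ.+ K′ → 0# ≤ pairing K K′ i
      pairing-nonneg-lower {i} 2i≤S =
        *-nonneg (x≤y⇒0≤y-x (f.coeff-antitone (reflect-≼ {i} 2i≤S)))
                 (x≤y⇒0≤y-x (g.coeff-antitone (shift-≼ {i} 2i≤S)))

      pairing-nonneg : ∀ i → 0# ≤ pairing K K′ i
      pairing-nonneg i with ℤ.≤-total (i ℤ.+ i) (K ℤ.+ K′)
      ... | inj₁ 2i≤S = pairing-nonneg-lower 2i≤S
      ... | inj₂ S≤2i =
        ≤-respʳ-≈ (pairing-reflect K K′ i) (pairing-nonneg-lower (reflect-lower {i} S≤2i))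

      coeff-*ₗ-step : coeff (f *ₗ g) (+ (k ℕ.+ ν)) ≤ coeff (f *ₗ g) (+ k)
      coeff-*ₗ-step = 0≤y-x⇒x≤y (0≤x+x⇒0≤x (≤-respʳ-≈
        (sym (coeff-*ₗ-double-difference K K′ _ ≡.refl)) (∑-nonneg _ (λ _ → pairing-nonneg _))))

  *ₗ∈U : ∀ {ν f g} → ν ℕ.∣ 2 → U R ν f → U R ν g → U R ν (f *ₗ g)
  *ₗ∈U {ν} {f} {g} ν∣2 f∈U g∈U =
    coeff-*ₗ-laurent , coeff-*ₗ-nonneg , coeff-*ₗ-sym ,
    steps⇒residueSteps ν (λ a b → coeff (f *ₗ g) (+ b) ≤ coeff (f *ₗ g) (+ a))
      (Antitone.coeff-*ₗ-step ν∣2)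
    where
    open Convolution f∈U g∈U

  module StrictConvolution {ν} {f g : LaurentPoly R} (ν∣2 : ν ℕ.∣ 2)
                           (f∈T : T R ν f) (g∈T : T R ν g) (k : ℕ) where
    open Convolution (proj₁ f∈T) (proj₁ g∈T)
    open Antitone ν∣2 k

    private
      instance
        ν-nonZero : ℕ.NonZero ν
        ν-nonZero = ∣2⇒nonZero ν∣2

      module f = StrictlyUnimodal f∈T
      module g = StrictlyUnimodal g∈T

      F G : ℤ → Carrier
      F = coeff f
      G = coeff g

      N : ℕ
      N = bound f

    pairing-≉0-lower : ∀ {i} → i ℤ.+ i ℤ.< K ℤ.+ K′ →
                       F i ≉ 0# → G (K ℤ.- i) ≉ 0# → pairing K K′ i ≉ 0#
    pairing-≉0-lower {i} 2i<S Fi≉0 Gi≉0 = x≉0⇒y≉0⇒x*y≉0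
      (x≉y⇒x-y≉0 (f.coeff-strictly-antitone Fi≉0 (reflect-≺ {i} 2i<S) ∘ sym))
      (x≉y⇒x-y≉0 (g.coeff-strictly-antitone Gi≉0 (shift-≺ {i} 2i<S) ∘ sym))

    -- At or above the centre (where i = K + K′ − i kills the pairing term), use the mirror image 2K − i
    -- of i about K instead: it lies strictly below the centre and keeps both factors nonzero.
    lower-witness : ∀ {i} → F i ≉ 0# → G (K ℤ.- i) ≉ 0# →
                    ∃[ j ] (j ℤ.+ j ℤ.< K ℤ.+ K′ × F j ≉ 0# × G (K ℤ.- j) ≉ 0#)
    lower-witness {i} Fi≉0 Gi≉0 with (i ℤ.+ i) ℤ.<? (K ℤ.+ K′)
    ... | yes 2i<S = i , 2i<S , Fi≉0 , Gi≉0
    ... | no  2i≮S = K ℤ.+ K ℤ.- i , mirror-lower {i} S≤2i , f.coeff-≉0-inward (mirror-≼ {i} S≤2i) Fi≉0 ,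
                     Gi≉0 ∘ trans (sym (trans (≡→≈ (cong G (K-mirror i))) (g.coeff-sym _)))
      where
      S≤2i : K ℤ.+ K′ ℤ.≤ i ℤ.+ i
      S≤2i = ℤ.≮⇒≥ 2i≮S

    -- ≈ is not decidable, so each summand of the coefficient at K is only shown to be ¬¬-zero.
    coeff-*ₗ-strict-step : coeff (f *ₗ g) (+ k) ≉ 0# →
                           coeff (f *ₗ g) (+ (k ℕ.+ ν)) ≉ coeff (f *ₗ g) (+ k)
    coeff-*ₗ-strict-step Pk≉0 Pk′≈Pk =
      ∑-¬¬≈0 (suc (2 ℕ.* N)) (λ {t} _ → summand-¬¬≈0 (ι t)) (Pk≉0 ∘ trans (≡→≈ (coeff-*ₗ K)))
      where
      c : ℕ
      c = k ℕ.+ (k ℕ.+ ν)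

      D≈0 : coeff (f *ₗ g) K - coeff (f *ₗ g) K′ ≈ 0#
      D≈0 = x≈y⇒x∙y⁻¹≈ε (sym Pk′≈Pk)

      pairing≈0 : ∀ {t} → t ℕ.< suc (2 ℕ.* N ℕ.+ c) → pairing K K′ (ι t) ≈ 0#
      pairing≈0 = ∑-nonneg-≈0 _ (λ _ → pairing-nonneg _) (trans
        (sym (coeff-*ₗ-double-difference K K′ c ≡.refl)) (trans (+-cong D≈0 D≈0) (+-identityʳ 0#)))

      summand-¬¬≈0 : ∀ i → ¬ ¬ F i * G (K ℤ.- i) ≈ 0#
      summand-¬¬≈0 i FG≉0 with lower-witness {i} (λ Fi≈0 → FG≉0 (trans (*-congʳ Fi≈0) (zeroˡ _)))
                                                 (λ Gi≈0 → FG≉0 (trans (*-congˡ Gi≈0) (zeroʳ _)))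
      ... | j , 2j<S , Fj≉0 , Gj≉0 with ι-onto-support c Fj≉0
      ... | t , t<L , ιt≡j =
        pairing-≉0-lower 2j<S Fj≉0 Gj≉0 (trans (≡→≈ (cong (pairing K K′) (≡.sym ιt≡j))) (pairing≈0 t<L))

  *ₗ∈T : ∀ {ν f g} → ν ℕ.∣ 2 → T R ν f → T R ν g → T R ν (f *ₗ g)
  *ₗ∈T {ν} {f} {g} ν∣2 f∈T g∈T = *ₗ∈U ν∣2 (proj₁ f∈T) (proj₁ g∈T) ,
    steps⇒residueSteps ν
      (λ a b → 0# < coeff (f *ₗ g) (+ a) → coeff (f *ₗ g) (+ b) < coeff (f *ₗ g) (+ a))
      (λ k (_ , 0≉Pk) → coeff-*ₗ-step k , coeff-*ₗ-strict-step k (0≉Pk ∘ sym))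
    where
    open Convolution.Antitone (proj₁ f∈T) (proj₁ g∈T) ν∣2 using (coeff-*ₗ-step)
    open StrictConvolution ν∣2 f∈T g∈T using (coeff-*ₗ-strict-step)

  U-isSubSemiring : ∀ {ν} → ν ℕ.∣ 2 → IsSubSemiring R (U R ν)
  U-isSubSemiring ν∣2 = 0ₗ∈U , 1ₗ∈U , (λ _ _ → +ₗ∈U) , (λ _ _ → *ₗ∈U ν∣2)

  T-isSubSemiring : ∀ {ν} → ν ℕ.∣ 2 → IsSubSemiring R (T R ν)
  T-isSubSemiring ν∣2 = 0ₗ∈T , 1ₗ∈T , (λ _ _ → +ₗ∈T) , (λ _ _ → *ₗ∈T ν∣2)

proposition1p2 : {c ℓ₁ ℓ₂ : Level} (R : RealNumbers c ℓ₁ ℓ₂) (ν : ℕ) → ν ≡ 1 ⊎ ν ≡ 2 →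
    IsSubSemiring R (U R ν) × IsSubSemiring R (T R ν)
proposition1p2 R ν ν≡1⊎ν≡2 = U-isSubSemiring R ν∣2 , T-isSubSemiring R ν∣2
  where
  ν∣2 : ν ℕ.∣ 2
  ν∣2 = [ (λ { ≡.refl → ℕ.1∣ 2 }) , (λ { ≡.refl → ℕ.∣-refl }) ] ν≡1⊎ν≡2
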